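{- Let $A,B\subset\mathbb{R}^d$ be disjoint finite nonempty sets and let $B'\subseteq B$ be nonempty, such that $\|\mu(A)-\mu(B')\|^2\le\|\mu(A)-\mu(B)\|^2$. Then $D(A,B')\le D(A,B)$.
   Context: For finite nonempty $Q$, $\mu(Q)$ is the centroid, $\Delta(Q)=\sum_{q\in Q}\|q-\mu(Q)\|^2$, and for disjoint $A,B$, $D(A,B)=\Delta(A\cup B)-\Delta(A)-\Delta(B)$. -}

module Defs where

open import Level using (Level; suc)
open import Data.Nat using (ℕ; zero) renaming (suc to 1+)
open import Data.Fin using (Fin)
open import Data.Vec using (Vec; zipWith; replicate; foldr; map)
open import Data.List using (List; length) renaming (foldr to lfoldr; map to lmap)
open import Relation.Binary.PropositionalEquality using (_≡_)
open import Relation.Binary.Structures using (IsTotalOrder)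
open import Algebra.Structures using (IsCommutativeRing)
open import Relation.Nullary using (¬_)

-- An ordered field (ℝ is one).  Equality is propositional equality;
-- the inverse is total, with the usual law for nonzero elements.
record OrderedField (c : Level) : Set (suc c) where
  infixl 6 _+_ _-_
  infixl 7 _*_
  infix 4 _≤_
  field
    Carrier : Set c
    _+_ _*_ : Carrier → Carrier → Carrier
    -_ : Carrier → Carrier
    0# 1# : Carrier
    _⁻¹ : Carrier → Carrier
    _≤_ : Carrier → Carrier → Set c
    isCommutativeRing : IsCommutativeRing _≡_ _+_ _*_ -_ 0# 1#
    0≢1 : ¬ (0# ≡ 1#)
    ⁻¹-inverse : ∀ x → ¬ (x ≡ 0#) → x * (x ⁻¹) ≡ 1#
    isTotalOrder : IsTotalOrder _≡_ _≤_
    +-mono-≤ : ∀ {x y} z → x ≤ y → x + z ≤ y + z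
    *-nonneg : ∀ {x y} → 0# ≤ x → 0# ≤ y → 0# ≤ x * y

  _-_ : Carrier → Carrier → Carrier
  x - y = x + (- y)

module Geometry {c : Level} (F : OrderedField c) where
  open OrderedField F

  Point : ℕ → Set c
  Point d = Vec Carrier d

  fromℕ : ℕ → Carrier
  fromℕ zero = 0#
  fromℕ (1+ n) = 1# + fromℕ n

  _⊕_ : ∀ {d} → Point d → Point d → Point d
  p ⊕ q = zipWith _+_ p q

  _⊖_ : ∀ {d} → Point d → Point d → Point d
  p ⊖ q = zipWith _-_ p q

  scale : ∀ {d} → Carrier → Point d → Point d
  scale a p = map (a *_) p

  ‖_‖² : ∀ {d} → Point d → Carrier
  ‖ p ‖² = foldr _ _+_ 0# (map (λ x → x * x) p)

  -- sum of points of a finite set (given as a duplicate-free list)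
  vsum : ∀ {d} → List (Point d) → Point d
  vsum {d} = lfoldr _⊕_ (replicate d 0#)

  ssum : List Carrier → Carrier
  ssum = lfoldr _+_ 0#

  μ : ∀ {d} → List (Point d) → Point d
  μ Q = scale (fromℕ (length Q) ⁻¹) (vsum Q)

  Δ : ∀ {d} → List (Point d) → Carrier
  Δ Q = ssum (lmap (λ q → ‖ q ⊖ μ Q ‖²) Q)

  -- D(A,B) = Δ(A ∪ B) − Δ(A) − Δ(B)   (A, B disjoint, so A ∪ B is A ++ B)
  D : ∀ {d} → List (Point d) → List (Point d) → Carrier
  D A B = Δ (A Data.List.++ B) - Δ A - Δ B

-- With a = |A|, b = |B| and Ward's formula (a + b) D(A,B) = a b ‖μ(A) − μ(B)‖², the cost
-- D(A,B) = (a b / (a + b)) ‖μ(A) − μ(B)‖² is increasing both in ‖μ(A) − μ(B)‖² and in b.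
-- Passing from B to B′ ⊆ B can only shrink b (B′ has no repetitions) and, by hypothesis,
-- shrinks the distance of centroids, so it cannot increase D.
module Submission where

open import Defs
open import Level using (Level)
open import Data.Nat using (ℕ)
open import Data.List using (List; [])
open import Data.List.Membership.Propositional using (_∈_)
open import Data.List.Relation.Binary.Subset.Propositional using (_⊆_)
open import Data.List.Relation.Unary.Unique.Propositional using (Unique)
open import Data.Empty using (⊥)
open import Relation.Nullary using (¬_)
open import Relation.Binary.PropositionalEquality using (_≡_)

open import Data.Nat using (zero; suc; z≤n; s≤s) renaming (_≤_ to _≤ℕ_)
import Data.Nat as ℕ
import Data.Nat.Properties as ℕₚ
open import Data.Integer as ℤ using (ℤ; -[1+_]; _◃_; sign; ∣_∣)
import Data.Integer.Properties as ℤₚ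
open import Data.Sign as Sign using (Sign)
open import Data.Vec using (_∷_; []; replicate)
open import Data.List using (_++_; length) renaming (_∷_ to _∷ₗ_; map to lmap)
import Data.List.Properties as List
open import Data.List.Relation.Unary.Any using (here; there; index; _─_)
open import Data.List.Relation.Unary.All as All using ()
open import Data.List.Relation.Unary.AllPairs using (_∷_)
open import Data.Maybe as Maybe using ()
open import Data.Sum using (inj₁; inj₂)
open import Data.Empty using (⊥-elim)
open import Function using (_∘_)
open import Relation.Binary.Bundles using (Poset)
open import Relation.Binary.Structures using (IsTotalOrder)
open import Relation.Binary.Consequences using (dec⇒weaklyDec)
open import Relation.Binary.PropositionalEquality
  using (_≢_; refl; sym; trans; cong; cong₂; subst₂; ≢-sym; module ≡-Reasoning)
open import Algebra.Bundles using (CommutativeRing)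
open import Algebra.Structures using (IsCommutativeRing)
open import Algebra.Solver.Ring.AlmostCommutativeRing
  using (fromCommutativeRing; _-Raw-AlmostCommutative⟶_)

module _ {a} {A : Set a} where

  ∈-─ : ∀ {x y : A} {ys} (y∈ys : y ∈ ys) → x ∈ ys → x ≢ y → x ∈ (ys ─ y∈ys)
  ∈-─ (here refl) (here refl)  x≢y = ⊥-elim (x≢y refl)
  ∈-─ (here refl) (there x∈ys) _   = x∈ys
  ∈-─ (there _)   (here refl)  _   = here refl
  ∈-─ (there y∈ys) (there x∈ys) x≢y = there (∈-─ y∈ys x∈ys x≢y)

  Unique-⊆⇒length≤ : ∀ {xs ys : List A} → Unique xs → xs ⊆ ys → length xs ≤ℕ length ys
  Unique-⊆⇒length≤ {[]} _ _ = z≤n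
  Unique-⊆⇒length≤ {x ∷ₗ xs} {ys} (x∉xs ∷ xs-unique) xs⊆ys =
    subst₂ _≤ℕ_ refl (sym (List.length-removeAt′ ys (index x∈ys)))
      (s≤s (Unique-⊆⇒length≤ xs-unique λ z∈xs →
        ∈-─ x∈ys (xs⊆ys (there z∈xs)) (≢-sym (All.lookup x∉xs z∈xs))))
    where x∈ys = xs⊆ys (here refl)

module _ {c : Level} (F : OrderedField c) where
  open OrderedField F
  open Geometry F
  open IsCommutativeRing isCommutativeRing
    using (+-assoc; +-comm; +-identityˡ; +-identityʳ; -‿inverseʳ; *-comm; *-identityˡ; distribʳ; zeroˡ; zeroʳ)
  open IsTotalOrder isTotalOrder using (total; antisym) renaming (refl to ≤-refl; trans to ≤-trans)
  private
    ring : CommutativeRing c c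
    ring = record { isCommutativeRing = isCommutativeRing }

    ≤-poset : Poset c c c
    ≤-poset = record { isPartialOrder = IsTotalOrder.isPartialOrder isTotalOrder }

  open import Algebra.Properties.Ring (CommutativeRing.ring ring)
    using (-‿distribˡ-*; -‿distribʳ-*; -0#≈0#)
  open import Algebra.Properties.AbelianGroup (CommutativeRing.+-abelianGroup ring)
    using (⁻¹-∙-comm; ⁻¹-involutive)
  open import Algebra.Properties.CommutativeSemigroup (CommutativeRing.+-commutativeSemigroup ring)
    using (interchange)

  module _ where
    open ≡-Reasoning

    fromℕ-+ : ∀ m n → fromℕ (m ℕ.+ n) ≡ fromℕ m + fromℕ n
    fromℕ-+ zero    n = sym (+-identityˡ (fromℕ n))
    fromℕ-+ (suc m) n = trans (cong (1# +_) (fromℕ-+ m n)) (sym (+-assoc 1# (fromℕ m) (fromℕ n)))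

    fromℕ-* : ∀ m n → fromℕ (m ℕ.* n) ≡ fromℕ m * fromℕ n
    fromℕ-* zero    n = sym (zeroˡ (fromℕ n))
    fromℕ-* (suc m) n = begin
      fromℕ (n ℕ.+ m ℕ.* n)              ≡⟨ fromℕ-+ n (m ℕ.* n) ⟩
      fromℕ n + fromℕ (m ℕ.* n)          ≡⟨ cong₂ _+_ (sym (*-identityˡ (fromℕ n))) (fromℕ-* m n) ⟩
      1# * fromℕ n + fromℕ m * fromℕ n   ≡⟨ sym (distribʳ (fromℕ n) 1# (fromℕ m)) ⟩
      (1# + fromℕ m) * fromℕ n           ∎

    [z+x]-[z+y]≡x-y : ∀ z x y → (z + x) - (z + y) ≡ x - y
    [z+x]-[z+y]≡x-y z x y = begin
      (z + x) + - (z + y)    ≡⟨ cong ((z + x) +_) (sym (⁻¹-∙-comm z y)) ⟩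
      (z + x) + (- z + - y)  ≡⟨ interchange z x (- z) (- y) ⟩
      (z + - z) + (x + - y)  ≡⟨ cong (_+ (x - y)) (-‿inverseʳ z) ⟩
      0# + (x - y)           ≡⟨ +-identityˡ (x - y) ⟩
      x - y                  ∎

    -- The ring solver needs a coefficient ring with decidable equality; F itself has none, so
    -- its coefficients are integers, interpreted in F along the canonical homomorphism ℤ → F.
    fromℤ : ℤ → Carrier
    fromℤ (ℤ.+ n)  = fromℕ n
    fromℤ -[1+ n ] = - fromℕ (suc n)

    fromℤ-⊖ : ∀ m n → fromℤ (m ℤ.⊖ n) ≡ fromℕ m - fromℕ n
    fromℤ-⊖ zero    zero    = sym (-‿inverseʳ 0#)
    fromℤ-⊖ zero    (suc n) = sym (+-identityˡ _)
    fromℤ-⊖ (suc m) zero    = sym (trans (cong (fromℕ (suc m) +_) -0#≈0#) (+-identityʳ _))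
    fromℤ-⊖ (suc m) (suc n) = begin
      fromℤ (suc m ℤ.⊖ suc n)          ≡⟨ cong fromℤ (ℤₚ.[1+m]⊖[1+n]≡m⊖n m n) ⟩
      fromℤ (m ℤ.⊖ n)                  ≡⟨ fromℤ-⊖ m n ⟩
      fromℕ m - fromℕ n                ≡⟨ sym ([z+x]-[z+y]≡x-y 1# (fromℕ m) (fromℕ n)) ⟩
      (1# + fromℕ m) - (1# + fromℕ n)  ∎

    fromℤ-+ : ∀ i j → fromℤ (i ℤ.+ j) ≡ fromℤ i + fromℤ j
    fromℤ-+ (ℤ.+ m)  (ℤ.+ n)  = fromℕ-+ m n
    fromℤ-+ (ℤ.+ m)  -[1+ n ] = fromℤ-⊖ m (suc n)
    fromℤ-+ -[1+ m ] (ℤ.+ n)  = trans (fromℤ-⊖ n (suc m)) (+-comm _ _)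
    fromℤ-+ -[1+ m ] -[1+ n ] = begin
      - fromℕ (suc (suc (m ℕ.+ n)))            ≡⟨ cong (λ k → - fromℕ k) (sym (ℕₚ.+-suc (suc m) n)) ⟩
      - fromℕ (suc m ℕ.+ suc n)                ≡⟨ cong -_ (fromℕ-+ (suc m) (suc n)) ⟩
      - (fromℕ (suc m) + fromℕ (suc n))        ≡⟨ sym (⁻¹-∙-comm _ _) ⟩
      - fromℕ (suc m) + - fromℕ (suc n)        ∎

    fromℤ-neg : ∀ i → fromℤ (ℤ.- i) ≡ - fromℤ i
    fromℤ-neg (ℤ.+ zero)  = sym -0#≈0#
    fromℤ-neg (ℤ.+ suc n) = refl
    fromℤ-neg -[1+ n ]    = sym (⁻¹-involutive _)

    signed : Sign → Carrier → Carrier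
    signed Sign.+ x = x
    signed Sign.- x = - x

    signed-* : ∀ s t x y → signed (s Sign.* t) (x * y) ≡ signed s x * signed t y
    signed-* Sign.+ Sign.+ x y = refl
    signed-* Sign.+ Sign.- x y = -‿distribʳ-* x y
    signed-* Sign.- Sign.+ x y = -‿distribˡ-* x y
    signed-* Sign.- Sign.- x y = begin
      x * y          ≡⟨ sym (⁻¹-involutive _) ⟩
      - (- (x * y))  ≡⟨ cong -_ (-‿distribʳ-* x y) ⟩
      - (x * - y)    ≡⟨ -‿distribˡ-* x (- y) ⟩
      - x * - y      ∎

    fromℤ-◃ : ∀ s n → fromℤ (s ◃ n) ≡ signed s (fromℕ n)
    fromℤ-◃ Sign.+ zero    = refl
    fromℤ-◃ Sign.- zero    = sym -0#≈0#
    fromℤ-◃ Sign.+ (suc n) = refl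
    fromℤ-◃ Sign.- (suc n) = refl

    fromℤ≡signed : ∀ i → fromℤ i ≡ signed (sign i) (fromℕ ∣ i ∣)
    fromℤ≡signed (ℤ.+ n)  = refl
    fromℤ≡signed -[1+ n ] = refl

    fromℤ-* : ∀ i j → fromℤ (i ℤ.* j) ≡ fromℤ i * fromℤ j
    fromℤ-* i j = begin
      fromℤ (i ℤ.* j)                                          ≡⟨ fromℤ-◃ (sign i Sign.* sign j) (∣ i ∣ ℕ.* ∣ j ∣) ⟩
      signed (sign i Sign.* sign j) (fromℕ (∣ i ∣ ℕ.* ∣ j ∣))   ≡⟨ cong (signed (sign i Sign.* sign j)) (fromℕ-* ∣ i ∣ ∣ j ∣) ⟩
      signed (sign i Sign.* sign j) (fromℕ ∣ i ∣ * fromℕ ∣ j ∣) ≡⟨ signed-* (sign i) (sign j) _ _ ⟩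
      signed (sign i) (fromℕ ∣ i ∣) * signed (sign j) (fromℕ ∣ j ∣) ≡⟨ sym (cong₂ _*_ (fromℤ≡signed i) (fromℤ≡signed j)) ⟩
      fromℤ i * fromℤ j                                        ∎

    fromℤ-homomorphism : ℤ.+-*-rawRing -Raw-AlmostCommutative⟶ fromCommutativeRing ring
    fromℤ-homomorphism = record
      { ⟦_⟧    = fromℤ
      ; +-homo = fromℤ-+
      ; *-homo = fromℤ-*
      ; -‿homo = fromℤ-neg
      ; 0-homo = refl
      ; 1-homo = +-identityʳ 1#
      }

  open import Algebra.Solver.Ring ℤ.+-*-rawRing (fromCommutativeRing ring) fromℤ-homomorphism
    (λ i j → Maybe.map (cong fromℤ) (dec⇒weaklyDec ℤ._≟_ i j))
    using (solve; _:=_; _:+_; _:*_; _:-_; :-_; con)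

  module _ where
    open ≡-Reasoning

    x≤y⇒0≤y-x : ∀ {x y} → x ≤ y → 0# ≤ y - x
    x≤y⇒0≤y-x {x} x≤y = subst₂ _≤_ (-‿inverseʳ x) refl (+-mono-≤ (- x) x≤y)

    0≤y-x⇒x≤y : ∀ {x y} → 0# ≤ y - x → x ≤ y
    0≤y-x⇒x≤y {x} {y} 0≤y-x =
      subst₂ _≤_ (+-identityˡ x) (solve 2 (λ x y → (y :- x) :+ x := y) refl x y) (+-mono-≤ x 0≤y-x)

    x*x-nonneg : ∀ x → 0# ≤ x * x
    x*x-nonneg x with total 0# x
    ... | inj₁ 0≤x = *-nonneg 0≤x 0≤x
    ... | inj₂ x≤0 = subst₂ _≤_ refl (solve 1 (λ x → (:- x) :* (:- x) := x :* x) refl x) (*-nonneg 0≤-x 0≤-x)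
      where 0≤-x = subst₂ _≤_ refl (+-identityˡ (- x)) (x≤y⇒0≤y-x x≤0)

    0≤1 : 0# ≤ 1#
    0≤1 = subst₂ _≤_ refl (*-identityˡ 1#) (x*x-nonneg 1#)

    +-monoʳ-≤ : ∀ {x y} z → x ≤ y → z + x ≤ z + y
    +-monoʳ-≤ {x} {y} z x≤y = subst₂ _≤_ (+-comm x z) (+-comm y z) (+-mono-≤ z x≤y)

    +-nonneg : ∀ {x y} → 0# ≤ x → 0# ≤ y → 0# ≤ x + y
    +-nonneg {x} {y} 0≤x 0≤y = ≤-trans 0≤y (subst₂ _≤_ (+-identityˡ y) refl (+-mono-≤ y 0≤x))

    +-nonneg-≢0 : ∀ {x y} → 0# ≤ x → ¬ (x ≡ 0#) → 0# ≤ y → ¬ (x + y ≡ 0#)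
    +-nonneg-≢0 {x} {y} 0≤x x≢0 0≤y x+y≡0 =
      x≢0 (antisym (subst₂ _≤_ (+-identityʳ x) x+y≡0 (+-monoʳ-≤ x 0≤y)) 0≤x)

    *-monoˡ-≤ : ∀ {z x y} → 0# ≤ z → x ≤ y → z * x ≤ z * y
    *-monoˡ-≤ {z} {x} {y} 0≤z x≤y = 0≤y-x⇒x≤y
      (subst₂ _≤_ refl (solve 3 (λ z x y → z :* (y :- x) := z :* y :- z :* x) refl z x y)
        (*-nonneg 0≤z (x≤y⇒0≤y-x x≤y)))

    *-cancelˡ-≤ : ∀ {z x y} → 0# ≤ z → ¬ (z ≡ 0#) → z * x ≤ z * y → x ≤ y
    *-cancelˡ-≤ {z} {x} {y} 0≤z z≢0 zx≤zy with total x y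
    ... | inj₁ x≤y = x≤y
    ... | inj₂ y≤x = subst₂ _≤_ refl x≡y ≤-refl
      where
        z⁻¹[z*_]≡id : ∀ w → (z ⁻¹) * (z * w) ≡ w
        z⁻¹[z*_]≡id w = begin
          (z ⁻¹) * (z * w)  ≡⟨ solve 3 (λ z i w → i :* (z :* w) := (z :* i) :* w) refl z (z ⁻¹) w ⟩
          (z * z ⁻¹) * w    ≡⟨ cong (_* w) (⁻¹-inverse z z≢0) ⟩
          1# * w            ≡⟨ *-identityˡ w ⟩
          w                 ∎
        x≡y : x ≡ y
        x≡y = begin
          x                 ≡⟨ sym (z⁻¹[z*_]≡id x) ⟩
          z ⁻¹ * (z * x)    ≡⟨ cong (z ⁻¹ *_) (antisym zx≤zy (*-monoˡ-≤ 0≤z y≤x)) ⟩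
          z ⁻¹ * (z * y)    ≡⟨ z⁻¹[z*_]≡id y ⟩
          y                 ∎

    fromℕ-nonneg : ∀ n → 0# ≤ fromℕ n
    fromℕ-nonneg zero    = ≤-refl
    fromℕ-nonneg (suc n) = +-nonneg 0≤1 (fromℕ-nonneg n)

    fromℕ-mono-≤ : ∀ {m n} → m ≤ℕ n → fromℕ m ≤ fromℕ n
    fromℕ-mono-≤ {n = n} z≤n = fromℕ-nonneg n
    fromℕ-mono-≤ (s≤s m≤n)  = +-monoʳ-≤ 1# (fromℕ-mono-≤ m≤n)

    fromℕ-length≢0 : ∀ {ℓ} {X : Set ℓ} {xs : List X} → ¬ (xs ≡ []) → ¬ (fromℕ (length xs) ≡ 0#)
    fromℕ-length≢0 {xs = []}      xs≢[] _ = xs≢[] refl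
    fromℕ-length≢0 {xs = _ ∷ₗ xs} _       =
      +-nonneg-≢0 0≤1 (λ 1≡0 → 0≢1 (sym 1≡0)) (fromℕ-nonneg (length xs))

    fromℕ-length-++ : ∀ {ℓ} {X : Set ℓ} (xs ys : List X)
      → fromℕ (length (xs ++ ys)) ≡ fromℕ (length xs) + fromℕ (length ys)
    fromℕ-length-++ xs ys = trans (cong fromℕ (List.length-++ xs)) (fromℕ-+ (length xs) (length ys))

    infixl 7 _·_

    _·_ : ∀ {d} → Point d → Point d → Carrier
    []      · []      = 0#
    (x ∷ p) · (y ∷ q) = x * y + p · q

    ‖‖²≡· : ∀ {d} (p : Point d) → ‖ p ‖² ≡ p · p
    ‖‖²≡· []      = refl
    ‖‖²≡· (x ∷ p) = cong (x * x +_) (‖‖²≡· p)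

    ‖‖²-nonneg : ∀ {d} (p : Point d) → 0# ≤ ‖ p ‖²
    ‖‖²-nonneg []      = ≤-refl
    ‖‖²-nonneg (x ∷ p) = +-nonneg (x*x-nonneg x) (‖‖²-nonneg p)

    ·-comm : ∀ {d} (p q : Point d) → p · q ≡ q · p
    ·-comm []      []      = refl
    ·-comm (x ∷ p) (y ∷ q) = cong₂ _+_ (*-comm x y) (·-comm p q)

    ·-zeroˡ : ∀ d (r : Point d) → replicate d 0# · r ≡ 0#
    ·-zeroˡ zero    []      = refl
    ·-zeroˡ (suc d) (z ∷ r) =
      trans (cong (0# * z +_) (·-zeroˡ d r)) (trans (+-identityʳ _) (zeroˡ z))

    ·-distribʳ-⊕ : ∀ {d} (p q r : Point d) → (p ⊕ q) · r ≡ p · r + q · r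
    ·-distribʳ-⊕ []      []      []      = sym (+-identityˡ 0#)
    ·-distribʳ-⊕ (x ∷ p) (y ∷ q) (z ∷ r) = trans (cong ((x + y) * z +_) (·-distribʳ-⊕ p q r))
      (solve 5 (λ x y z u v → (x :+ y) :* z :+ (u :+ v) := (x :* z :+ u) :+ (y :* z :+ v)) refl x y z (p · r) (q · r))

    ·-distribʳ-⊖ : ∀ {d} (p q r : Point d) → (p ⊖ q) · r ≡ p · r - q · r
    ·-distribʳ-⊖ []      []      []      = sym (-‿inverseʳ 0#)
    ·-distribʳ-⊖ (x ∷ p) (y ∷ q) (z ∷ r) = trans (cong ((x - y) * z +_) (·-distribʳ-⊖ p q r))
      (solve 5 (λ x y z u v → (x :- y) :* z :+ (u :- v) := (x :* z :+ u) :- (y :* z :+ v)) refl x y z (p · r) (q · r))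

    ·-distribˡ-⊖ : ∀ {d} (p q r : Point d) → p · (q ⊖ r) ≡ p · q - p · r
    ·-distribˡ-⊖ p q r =
      trans (·-comm p (q ⊖ r)) (trans (·-distribʳ-⊖ q r p) (cong₂ _-_ (·-comm q p) (·-comm r p)))

    scale-· : ∀ {d} a (p r : Point d) → scale a p · r ≡ a * (p · r)
    scale-· a []      []      = sym (zeroʳ a)
    scale-· a (x ∷ p) (z ∷ r) = trans (cong ((a * x) * z +_) (scale-· a p r))
      (solve 4 (λ a x z u → (a :* x) :* z :+ a :* u := a :* (x :* z :+ u)) refl a x z (p · r))

    ‖⊖‖²-expand : ∀ {d} (p q : Point d) → ‖ p ⊖ q ‖² ≡ p · p - (p · q + p · q) + q · q
    ‖⊖‖²-expand p q = begin
      ‖ p ⊖ q ‖²                            ≡⟨ ‖‖²≡· (p ⊖ q) ⟩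
      (p ⊖ q) · (p ⊖ q)                     ≡⟨ ·-distribʳ-⊖ p q (p ⊖ q) ⟩
      p · (p ⊖ q) - q · (p ⊖ q)             ≡⟨ cong₂ _-_ (·-distribˡ-⊖ p p q) (·-distribˡ-⊖ q p q) ⟩
      (p · p - p · q) - (q · p - q · q)     ≡⟨ cong (λ w → (p · p - p · q) - (w - q · q)) (·-comm q p) ⟩
      (p · p - p · q) - (p · q - q · q)     ≡⟨ solve 3 (λ x y z → (x :- y) :- (y :- z) := x :- (y :+ y) :+ z) refl (p · p) (p · q) (q · q) ⟩
      p · p - (p · q + p · q) + q · q       ∎

    ssum-map-++ : ∀ {d} (f : Point d → Carrier) xs ys
      → ssum (lmap f (xs ++ ys)) ≡ ssum (lmap f xs) + ssum (lmap f ys)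
    ssum-map-++ f []        ys = sym (+-identityˡ _)
    ssum-map-++ f (x ∷ₗ xs) ys = trans (cong (f x +_) (ssum-map-++ f xs ys)) (sym (+-assoc (f x) _ _))

    vsum-·-++ : ∀ {d} (xs ys : List (Point d)) r → vsum (xs ++ ys) · r ≡ vsum xs · r + vsum ys · r
    vsum-·-++ {d} []        ys r = sym (trans (cong (_+ vsum ys · r) (·-zeroˡ d r)) (+-identityˡ _))
    vsum-·-++     (x ∷ₗ xs) ys r = begin
      (x ⊕ vsum (xs ++ ys)) · r                ≡⟨ ·-distribʳ-⊕ x (vsum (xs ++ ys)) r ⟩
      x · r + vsum (xs ++ ys) · r              ≡⟨ cong (x · r +_) (vsum-·-++ xs ys r) ⟩
      x · r + (vsum xs · r + vsum ys · r)      ≡⟨ sym (+-assoc (x · r) _ _) ⟩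
      (x · r + vsum xs · r) + vsum ys · r      ≡⟨ cong (_+ vsum ys · r) (sym (·-distribʳ-⊕ x (vsum xs) r)) ⟩
      (x ⊕ vsum xs) · r + vsum ys · r          ∎

    sumSq : ∀ {d} → List (Point d) → Carrier
    sumSq Q = ssum (lmap (λ q → q · q) Q)

    sumSqDist-expand : ∀ {d} (m : Point d) Q
      → ssum (lmap (λ q → ‖ q ⊖ m ‖²) Q) ≡ sumSq Q - (vsum Q · m + vsum Q · m) + fromℕ (length Q) * (m · m)
    sumSqDist-expand {d} m [] = begin
      0#                                           ≡⟨ solve 1 (λ x → con (ℤ.+ 0) := con (ℤ.+ 0) :- (con (ℤ.+ 0) :+ con (ℤ.+ 0)) :+ con (ℤ.+ 0) :* x) refl (m · m) ⟩
      0# - (0# + 0#) + 0# * (m · m)                ≡⟨ cong (λ w → 0# - (w + w) + 0# * (m · m)) (sym (·-zeroˡ d m)) ⟩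
      0# - (vsum [] · m + vsum [] · m) + 0# * (m · m) ∎
    sumSqDist-expand m (q ∷ₗ Q) = begin
      ‖ q ⊖ m ‖² + ssum (lmap (λ q → ‖ q ⊖ m ‖²) Q)
        ≡⟨ cong₂ _+_ (‖⊖‖²-expand q m) (sumSqDist-expand m Q) ⟩
      (q · q - (q · m + q · m) + m · m) + (sumSq Q - (vsum Q · m + vsum Q · m) + n * (m · m))
        ≡⟨ solve 6 (λ a b c s l n → (a :- (b :+ b) :+ c) :+ (s :- (l :+ l) :+ n :* c)
                                     := (a :+ s) :- ((b :+ l) :+ (b :+ l)) :+ (con (ℤ.+ 1) :+ n) :* c)
                   refl (q · q) (q · m) (m · m) (sumSq Q) (vsum Q · m) n ⟩
      sumSq (q ∷ₗ Q) - ((q · m + vsum Q · m) + (q · m + vsum Q · m)) + ((1# + 0#) + n) * (m · m)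
        ≡⟨ cong₂ (λ v k → sumSq (q ∷ₗ Q) - (v + v) + (k + n) * (m · m))
                 (sym (·-distribʳ-⊕ q (vsum Q) m)) (+-identityʳ 1#) ⟩
      sumSq (q ∷ₗ Q) - (vsum (q ∷ₗ Q) · m + vsum (q ∷ₗ Q) · m) + (1# + n) * (m · m) ∎
      where n = fromℕ (length Q)

    centroid-· : ∀ {d} {Q : List (Point d)} → ¬ (Q ≡ []) → ∀ r → fromℕ (length Q) * (μ Q · r) ≡ vsum Q · r
    centroid-· {Q = Q} Q≢[] r = begin
      n * (scale (n ⁻¹) (vsum Q) · r)  ≡⟨ cong (n *_) (scale-· (n ⁻¹) (vsum Q) r) ⟩
      n * (n ⁻¹ * (vsum Q · r))        ≡⟨ solve 3 (λ n i x → n :* (i :* x) := (n :* i) :* x) refl n (n ⁻¹) (vsum Q · r) ⟩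
      (n * n ⁻¹) * (vsum Q · r)        ≡⟨ cong (_* (vsum Q · r)) (⁻¹-inverse n (fromℕ-length≢0 Q≢[])) ⟩
      1# * (vsum Q · r)                ≡⟨ *-identityˡ _ ⟩
      vsum Q · r                       ∎
      where n = fromℕ (length Q)

    Δ≡sumSq-∣Q∣*μ·μ : ∀ {d} {Q : List (Point d)} → ¬ (Q ≡ []) → Δ Q ≡ sumSq Q - fromℕ (length Q) * (μ Q · μ Q)
    Δ≡sumSq-∣Q∣*μ·μ {Q = Q} Q≢[] = begin
      Δ Q                                      ≡⟨ sumSqDist-expand (μ Q) Q ⟩
      sumSq Q - (vsum Q · μ Q + vsum Q · μ Q) + n * x
        ≡⟨ cong (λ v → sumSq Q - (v + v) + n * x) (sym (centroid-· Q≢[] (μ Q))) ⟩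
      sumSq Q - (n * x + n * x) + n * x        ≡⟨ solve 3 (λ s n x → s :- (n :* x :+ n :* x) :+ n :* x := s :- n :* x) refl (sumSq Q) n x ⟩
      sumSq Q - n * x                          ∎
      where n = fromℕ (length Q)
            x = μ Q · μ Q

    ++-centroid-· : ∀ {d} {A B : List (Point d)} → ¬ (A ≡ []) → ¬ (B ≡ []) → ∀ r
      → (fromℕ (length A) + fromℕ (length B)) * (μ (A ++ B) · r)
          ≡ fromℕ (length A) * (μ A · r) + fromℕ (length B) * (μ B · r)
    ++-centroid-· {A = A} {B} A≢[] B≢[] r = begin
      (fromℕ (length A) + fromℕ (length B)) * (μ (A ++ B) · r)  ≡⟨ cong (_* (μ (A ++ B) · r)) (sym (fromℕ-length-++ A B)) ⟩
      fromℕ (length (A ++ B)) * (μ (A ++ B) · r)               ≡⟨ centroid-· (A≢[] ∘ List.++-conicalˡ A B) r ⟩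
      vsum (A ++ B) · r                                        ≡⟨ vsum-·-++ A B r ⟩
      vsum A · r + vsum B · r                                  ≡⟨ sym (cong₂ _+_ (centroid-· A≢[] r) (centroid-· B≢[] r)) ⟩
      fromℕ (length A) * (μ A · r) + fromℕ (length B) * (μ B · r) ∎

    D-centroid-expansion : ∀ {d} {A B : List (Point d)} → ¬ (A ≡ []) → ¬ (B ≡ [])
      → D A B ≡ fromℕ (length A) * (μ A · μ A) + fromℕ (length B) * (μ B · μ B)
                  - (fromℕ (length A) + fromℕ (length B)) * (μ (A ++ B) · μ (A ++ B))
    D-centroid-expansion {A = A} {B} A≢[] B≢[] = begin
      Δ (A ++ B) - Δ A - Δ B
        ≡⟨ cong₂ (λ u v → u - v - Δ B) (Δ≡sumSq-∣Q∣*μ·μ (A≢[] ∘ List.++-conicalˡ A B)) (Δ≡sumSq-∣Q∣*μ·μ A≢[]) ⟩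
      (sumSq (A ++ B) - fromℕ (length (A ++ B)) * w) - (sumSq A - a * x) - Δ B
        ≡⟨ cong₂ (λ u v → (u - v * w) - (sumSq A - a * x) - Δ B) (ssum-map-++ (λ q → q · q) A B) (fromℕ-length-++ A B) ⟩
      (sumSq A + sumSq B - (a + b) * w) - (sumSq A - a * x) - Δ B
        ≡⟨ cong (λ v → (sumSq A + sumSq B - (a + b) * w) - (sumSq A - a * x) - v) (Δ≡sumSq-∣Q∣*μ·μ B≢[]) ⟩
      (sumSq A + sumSq B - (a + b) * w) - (sumSq A - a * x) - (sumSq B - b * y)
        ≡⟨ solve 7 (λ sA sB a b w x y → (sA :+ sB :- (a :+ b) :* w) :- (sA :- a :* x) :- (sB :- b :* y)
                                         := a :* x :+ b :* y :- (a :+ b) :* w)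
                   refl (sumSq A) (sumSq B) a b w x y ⟩
      a * x + b * y - (a + b) * w ∎
      where a = fromℕ (length A)
            b = fromℕ (length B)
            w = μ (A ++ B) · μ (A ++ B)
            x = μ A · μ A
            y = μ B · μ B

    ward-formula : ∀ {d} {A B : List (Point d)} → ¬ (A ≡ []) → ¬ (B ≡ [])
      → (fromℕ (length A) + fromℕ (length B)) * D A B ≡ fromℕ (length A) * fromℕ (length B) * ‖ μ A ⊖ μ B ‖²
    ward-formula {A = A} {B} A≢[] B≢[] = begin
      (a + b) * D A B                                   ≡⟨ cong ((a + b) *_) (D-centroid-expansion A≢[] B≢[]) ⟩
      (a + b) * (a * x + b * y - (a + b) * w)           ≡⟨ cong (λ e → (a + b) * (a * x + b * y - e)) [a+b]w ⟩
      (a + b) * (a * x + b * y - (a * u + b * v))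
        ≡⟨ solve 6 (λ a b x y u v → (a :+ b) :* (a :* x :+ b :* y :- (a :* u :+ b :* v))
                                     := (a :+ b) :* (a :* x :+ b :* y) :- a :* ((a :+ b) :* u) :- b :* ((a :+ b) :* v))
                   refl a b x y u v ⟩
      (a + b) * (a * x + b * y) - a * ((a + b) * u) - b * ((a + b) * v)
        ≡⟨ cong₂ (λ e f → (a + b) * (a * x + b * y) - a * e - b * f) [a+b]u [a+b]v ⟩
      (a + b) * (a * x + b * y) - a * (a * x + b * z) - b * (a * z + b * y)
        ≡⟨ solve 5 (λ a b x y z → (a :+ b) :* (a :* x :+ b :* y) :- a :* (a :* x :+ b :* z) :- b :* (a :* z :+ b :* y)
                                   := a :* b :* (x :- (z :+ z) :+ y))
                   refl a b x y z ⟩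
      a * b * (x - (z + z) + y)                         ≡⟨ cong (a * b *_) (sym (‖⊖‖²-expand (μ A) (μ B))) ⟩
      a * b * ‖ μ A ⊖ μ B ‖²                            ∎
      where
        a = fromℕ (length A)
        b = fromℕ (length B)
        m = μ (A ++ B)
        w = m · m
        u = m · μ A
        v = m · μ B
        x = μ A · μ A
        y = μ B · μ B
        z = μ A · μ B
        [a+b]w : (a + b) * w ≡ a * u + b * v
        [a+b]w = trans (++-centroid-· A≢[] B≢[] m) (cong₂ (λ e f → a * e + b * f) (·-comm (μ A) m) (·-comm (μ B) m))
        [a+b]u : (a + b) * u ≡ a * x + b * z
        [a+b]u = trans (++-centroid-· A≢[] B≢[] (μ A)) (cong (λ e → a * x + b * e) (·-comm (μ B) (μ A)))
        [a+b]v : (a + b) * v ≡ a * z + b * y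
        [a+b]v = ++-centroid-· A≢[] B≢[] (μ B)

  -- X = a b t / (a + b) and X′ = a b′ t′ / (a + b′), written without division.
  ab/[a+b]-mono : ∀ {a b b′ t t′ X X′} → 0# ≤ a → ¬ (a ≡ 0#) → 0# ≤ b′ → b′ ≤ b → 0# ≤ t → t′ ≤ t
    → (a + b) * X ≡ a * b * t → (a + b′) * X′ ≡ a * b′ * t′ → X′ ≤ X
  ab/[a+b]-mono {a} {b} {b′} {t} {t′} {X} {X′} 0≤a a≢0 0≤b′ b′≤b 0≤t t′≤t X-def X′-def =
    *-cancelˡ-≤ 0≤a+b′ (+-nonneg-≢0 0≤a a≢0 0≤b′)
      (*-cancelˡ-≤ 0≤a+b (+-nonneg-≢0 0≤a a≢0 0≤b) cross-multiplied)
    where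
      open import Relation.Binary.Reasoning.PartialOrder ≤-poset
      0≤b = ≤-trans 0≤b′ b′≤b
      0≤a+b = +-nonneg 0≤a 0≤b
      0≤a+b′ = +-nonneg 0≤a 0≤b′
      cross-multiplied : (a + b) * ((a + b′) * X′) ≤ (a + b) * ((a + b′) * X)
      cross-multiplied = begin
        (a + b) * ((a + b′) * X′)    ≡⟨ cong ((a + b) *_) X′-def ⟩
        (a + b) * (a * b′ * t′)      ≤⟨ *-monoˡ-≤ 0≤a+b (*-monoˡ-≤ (*-nonneg 0≤a 0≤b′) t′≤t) ⟩
        (a + b) * (a * b′ * t)       ≡⟨ solve 4 (λ a b b′ t → (a :+ b) :* (a :* b′ :* t) := (a :* t) :* (a :* b′ :+ b :* b′)) refl a b b′ t ⟩
        (a * t) * (a * b′ + b * b′)  ≤⟨ *-monoˡ-≤ (*-nonneg 0≤a 0≤t) (+-mono-≤ (b * b′) (*-monoˡ-≤ 0≤a b′≤b)) ⟩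
        (a * t) * (a * b + b * b′)   ≡⟨ solve 4 (λ a b b′ t → (a :* t) :* (a :* b :+ b :* b′) := (a :+ b′) :* (a :* b :* t)) refl a b b′ t ⟩
        (a + b′) * (a * b * t)       ≡⟨ cong ((a + b′) *_) (sym X-def) ⟩
        (a + b′) * ((a + b) * X)     ≡⟨ solve 3 (λ a′ b′ x → a′ :* (b′ :* x) := b′ :* (a′ :* x)) refl (a + b′) (a + b) X ⟩
        (a + b) * ((a + b′) * X)     ∎

corollary25 : ∀ {c : Level} (F : OrderedField c) (d : ℕ)
    → let open OrderedField F
          open Geometry F
      in (A B B′ : List (Point d))
    → Unique A → Unique B → Unique B′
    → ¬ (A ≡ []) → ¬ (B ≡ []) → ¬ (B′ ≡ [])
    → (∀ {p} → p ∈ A → p ∈ B → ⊥)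
    → B′ ⊆ B
    → ‖ μ A ⊖ μ B′ ‖² ≤ ‖ μ A ⊖ μ B ‖²
    → D A B′ ≤ D A B
corollary25 F d A B B′ _ _ B′-unique A≢[] B≢[] B′≢[] _ B′⊆B μB′-closer =
  ab/[a+b]-mono F (fromℕ-nonneg F (length A)) (fromℕ-length≢0 F A≢[]) (fromℕ-nonneg F (length B′))
    (fromℕ-mono-≤ F (Unique-⊆⇒length≤ B′-unique B′⊆B)) (‖‖²-nonneg F (μ A ⊖ μ B)) μB′-closer
    (ward-formula F A≢[] B≢[]) (ward-formula F A≢[] B′≢[])
  where open Geometry F using (μ; _⊖_)
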